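{- Let $G$ be a biconnected outerplanar graph and let $\{e_1,e_2,e_3\}$ be an order-respecting matching $e_1,e_2,e_3$ in $G$ such that $e_1$ and $e_3$ are exterior edges and $e_2$ is an interior edge. Then the graph $G':=G-(V(e_1)\cup V(e_3))$ is connected and $N_G(V(G'))=V(e_1)\cup V(e_3)$.
   Context: Graphs are finite, simple and undirected. A graph is outerplanar if it admits a plane embedding with all vertices on the outer face; biconnected if it has no articulation point. For a biconnected outerplanar graph, all embeddings with all vertices on the outer face have the same faces; an edge is exterior if it lies on the boundary of the outer face of such an embedding (equivalently, for at least three vertices, it lies on the unique Hamiltonian cycle), and interior otherwise (a chord of that cycle). A sequence of edges $e_1,\ldots,e_\ell$ is an order-respecting matching if they are pairwise vertex-disjoint and for all $1\le i<j<k\le\ell$ the edges $e_i$ and $e_k$ lie in different connected components of $G-V(e_j)$, where $V(e)$ is the set of endpoints of $e$. -}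

module Defs where

open import Data.Nat using (ℕ; zero; suc; _<_)
open import Data.Fin using (Fin; toℕ)
import Data.Fin as Fin
open import Data.Product using (Σ; ∃; _×_; _,_; proj₁; proj₂)
open import Data.Sum using (_⊎_)
open import Data.Empty using (⊥)
open import Relation.Nullary using (¬_)
open import Relation.Binary.PropositionalEquality using (_≡_)
open import Function.Definitions using (Injective)

record Graph (n : ℕ) : Set₁ where
  field
    Adj   : Fin n → Fin n → Set
    sym   : ∀ {u v} → Adj u v → Adj v u
    irrefl : ∀ {u} → ¬ Adj u u
open Graph public

record Edge {n : ℕ} (G : Graph n) : Set where
  constructor edge
  field
    ends₁ : Fin n
    ends₂ : Fin n
    adj   : Adj G ends₁ ends₂
open Edge public

V : ∀ {n} {G : Graph n} → Edge G → Fin n → Set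
V e w = w ≡ ends₁ e ⊎ w ≡ ends₂ e

VSet : ℕ → Set₁
VSet n = Fin n → Set

_∪_ : ∀ {n} → VSet n → VSet n → VSet n
(S ∪ T) w = S w ⊎ T w

∅ : ∀ {n} → VSet n
∅ _ = ⊥

｛_｝ : ∀ {n} → Fin n → VSet n
｛ v ｝ w = w ≡ v

-- A walk from u to v in G - S: every vertex on it lies outside S and
-- consecutive vertices are adjacent in G.
data Walk {n : ℕ} (G : Graph n) (S : VSet n) : Fin n → Fin n → Set where
  here : ∀ {u} → ¬ S u → Walk G S u u
  step : ∀ {u w v} → ¬ S u → Adj G u w → Walk G S w v → Walk G S u v

AllReachable : ∀ {n} → Graph n → VSet n → Set
AllReachable G S = ∀ u v → ¬ S u → ¬ S v → Walk G S u v

ConnectedMinus : ∀ {n} → Graph n → VSet n → Set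
ConnectedMinus G S = (∃ λ u → ¬ S u) × AllReachable G S

Connected : ∀ {n} → Graph n → Set
Connected G = ConnectedMinus G ∅

Biconnected : ∀ {n} → Graph n → Set
Biconnected G = Connected G × (∀ v → AllReachable G ｛ v ｝)

-- Outerplanarity (combinatorial: vertices on a circle, edges as
-- non-crossing chords)

record OuterplanarEmbedding {n : ℕ} (G : Graph n) : Set where
  field
    pos    : Fin n → Fin n
    pos-inj : Injective _≡_ _≡_ pos
    noncrossing : ∀ a b c d → Adj G a b → Adj G c d →
                  ¬ (toℕ (pos a) < toℕ (pos c) ×
                     toℕ (pos c) < toℕ (pos b) ×
                     toℕ (pos b) < toℕ (pos d))
open OuterplanarEmbedding public

Outerplanar : ∀ {n} → Graph n → Set
Outerplanar G = OuterplanarEmbedding G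

CyclicSucc : ∀ {n} → Fin n → Fin n → Set
CyclicSucc {n} i j = suc (toℕ i) ≡ toℕ j ⊎ (suc (toℕ i) ≡ n × toℕ j ≡ 0)

CircleAdjacent : ∀ {n} → Fin n → Fin n → Set
CircleAdjacent i j = CyclicSucc i j ⊎ CyclicSucc j i

-- An edge is exterior if it lies on the boundary of the outer face of an
-- outerplanar embedding, i.e. its endpoints are consecutive on the circle.
Exterior : ∀ {n} {G : Graph n} → Edge G → Set
Exterior {G = G} e = ∃ λ (E : OuterplanarEmbedding G) →
  CircleAdjacent (pos E (ends₁ e)) (pos E (ends₂ e))

Interior : ∀ {n} {G : Graph n} → Edge G → Set
Interior e = ¬ Exterior e

VertexDisjoint : ∀ {n} {G : Graph n} → Edge G → Edge G → Set
VertexDisjoint e f = ∀ w → V e w → ¬ V f w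

-- e and f lie in different connected components of G - S
-- (both assumed to lie in G - S).
DifferentComponents : ∀ {n} (G : Graph n) → VSet n → Edge G → Edge G → Set
DifferentComponents G S e f = ¬ Walk G S (ends₁ e) (ends₁ f)

OrderRespecting : ∀ {n} {G : Graph n} (ℓ : ℕ) → (Fin ℓ → Edge G) → Set
OrderRespecting {G = G} ℓ es =
  (∀ i j → ¬ i ≡ j → VertexDisjoint (es i) (es j)) ×
  (∀ i j k → i Fin.< j → j Fin.< k → DifferentComponents G (V (es j)) (es i) (es k))

seq3 : ∀ {n} {G : Graph n} → Edge G → Edge G → Edge G → Fin 3 → Edge G
seq3 e₁ e₂ e₃ Fin.zero = e₁
seq3 e₁ e₂ e₃ (Fin.suc Fin.zero) = e₂
seq3 e₁ e₂ e₃ (Fin.suc (Fin.suc Fin.zero)) = e₃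

N : ∀ {n} → Graph n → VSet n → VSet n
N G X w = ¬ X w × ∃ λ x → X x × Adj G w x

Complement : ∀ {n} → VSet n → VSet n
Complement S w = ¬ S w

-- Removing both ends of an exterior edge ab leaves the rest connected: by
-- biconnectivity any two other vertices are joined avoiding b, and a detour
-- p a q through a can be rerouted, because a walk from q to p avoiding a that
-- reached b first would, with the circle read from a to b, jump over p by an
-- edge crossing ap. So from any vertex of G' one can walk towards e₂ both
-- avoiding V(e₁) and avoiding V(e₃); if both walks met the other exterior edge
-- before e₂, gluing them would join e₁ to e₃ in G - V(e₂), which the
-- order-respecting condition forbids. The same condition rules out edges
-- between e₁ and e₃, so the neighbour off its own edge that biconnectivity
-- gives each endpoint lies in G'.
module Submission where

open import Defs
open import Data.Nat using (ℕ; _+_; _≤_; _<_; z≤n; s≤s; _≤?_; s≤s⁻¹)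
open import Data.Nat.Properties
  using (<⇒≤; <⇒≱; n≮0; ≰⇒>; ≤∧≢⇒<; <-irrefl; <-asym; <-≤-trans; <-trans; <-cmp;
         +-cancelʳ-≡; +-cancelʳ-<; m≤n+m; m+n≮n; +-monoˡ-≤; ≤-trans; ≤-refl)
open import Data.Fin using (Fin; toℕ; _≟_; #_)
open import Data.Fin.Properties using (toℕ-injective; toℕ<n)
open import Data.Product using (∃; ∃₂; _×_; _,_; proj₂)
open import Data.Sum using (_⊎_; inj₁; inj₂; [_,_]; swap)
open import Data.Empty using (⊥; ⊥-elim)
open import Relation.Nullary using (¬_; yes; no)
open import Relation.Nullary.Decidable using (decidable-stable)
open import Relation.Unary using (_⊆_; ∁; Decidable)
open import Relation.Unary.Properties using (_∪?_)
open import Relation.Binary.PropositionalEquality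
  using (_≡_; refl; cong; subst) renaming (sym to ≡-sym)
open import Relation.Binary.Definitions using (tri<; tri≈; tri>)
open import Function.Base using (_∘_)
open import Function.Bundles using (_⇔_; mk⇔)

module _ {n : ℕ} {G : Graph n} where

  source∉ : ∀ {S u v} → Walk G S u v → ¬ S u
  source∉ (here p) = p
  source∉ (step p _ _) = p

  target∉ : ∀ {S u v} → Walk G S u v → ¬ S v
  target∉ (here p) = p
  target∉ (step _ _ W) = target∉ W

  infixr 5 _++ʷ_
  _++ʷ_ : ∀ {S u v w} → Walk G S u v → Walk G S v w → Walk G S u w
  here _ ++ʷ W′ = W′
  step p a W ++ʷ W′ = step p a (W ++ʷ W′)

  extend : ∀ {S u v w} → Walk G S u v → Adj G v w → ¬ S w → Walk G S u w
  extend W a p = W ++ʷ step (target∉ W) a (here p)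

  reverse : ∀ {S u v} → Walk G S u v → Walk G S v u
  reverse (here p) = here p
  reverse (step p a W) = extend (reverse W) (Graph.sym G a) p

  walk-antimono : ∀ {S S′ : VSet n} {u v} → S′ ⊆ S → Walk G S u v → Walk G S′ u v
  walk-antimono S′⊆S (here p) = here (λ s → p (S′⊆S s))
  walk-antimono S′⊆S (step p a W) = step (λ s → p (S′⊆S s)) a (walk-antimono S′⊆S W)

  V? : (e : Edge G) → Decidable (V e)
  V? e = (_≟ ends₁ e) ∪? (_≟ ends₂ e)

  first-entry : ∀ {S T u t} → Decidable T → Walk G S u t → T t →
                T u ⊎ ∃₂ λ w z → Walk G (S ∪ T) u w × Adj G w z × T z
  first-entry T? (here _) Tt = inj₁ Tt
  first-entry {u = u} T? (step p a W) Tt with T? u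
  ... | yes Tu = inj₁ Tu
  ... | no u∉T with first-entry T? W Tt
  ...   | inj₁ Tw = inj₂ (_ , _ , here [ p , u∉T ] , a , Tw)
  ...   | inj₂ (w , z , W′ , a′ , Tz) = inj₂ (w , z , step [ p , u∉T ] a W′ , a′ , Tz)

-- Reading the circle from position pos a onwards: positions before pos a are
-- moved behind the last one, so rank a is least and the order is a rotation
-- of the order by positions.
module Rotation {n : ℕ} {G : Graph n} (E : OuterplanarEmbedding G) (a : Fin n) where

  P : Fin n → ℕ
  P v = toℕ (pos E v)

  A : ℕ
  A = P a

  shift : ℕ → ℕ
  shift k with A ≤? k
  ... | yes _ = k
  ... | no _ = k + n

  data Shift (k : ℕ) : ℕ → Set where
    kept  : A ≤ k → Shift k k
    moved : k < A → Shift k (k + n)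

  shift-view : ∀ k → Shift k (shift k)
  shift-view k with A ≤? k
  ... | yes A≤k = kept A≤k
  ... | no A≰k = moved (≰⇒> A≰k)

  rank : Fin n → ℕ
  rank v = shift (P v)

  P<n : ∀ v → P v < n
  P<n v = toℕ<n (pos E v)

  moved≮kept : ∀ {k} v → ¬ (k + n < P v)
  moved≮kept {k} v lt = m+n≮n k n (<-trans lt (P<n v))

  rank-injective : ∀ {u v} → rank u ≡ rank v → u ≡ v
  rank-injective {u} {v} eq = pos-inj E (toℕ-injective (P-eq eq))
    where
    P-eq : rank u ≡ rank v → P u ≡ P v
    P-eq with rank u | shift-view (P u) | rank v | shift-view (P v)
    ... | _ | kept _  | _ | kept _  = λ eq → eq
    ... | _ | moved _ | _ | moved _ = +-cancelʳ-≡ n (P u) (P v)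
    ... | _ | kept _  | _ | moved _ = λ eq → ⊥-elim (m+n≮n (P v) n (subst (_< n) eq (P<n u)))
    ... | _ | moved _ | _ | kept _  = λ eq → ⊥-elim (m+n≮n (P u) n (subst (_< n) (≡-sym eq) (P<n v)))

  rank-base : rank a ≡ A
  rank-base with rank a | shift-view A
  ... | _ | kept _ = refl
  ... | _ | moved A<A = ⊥-elim (<-irrefl refl A<A)

  rank-minimal : ∀ v → rank a ≤ rank v
  rank-minimal v rewrite rank-base with rank v | shift-view (P v)
  ... | _ | kept A≤v = A≤v
  ... | _ | moved _ = ≤-trans (<⇒≤ (P<n a)) (m≤n+m n (P v))

  -- A crossing in rank order is a cyclic rotation of a crossing in position order.
  rank-noncrossing : ∀ {x y z w} → Adj G x z → Adj G y w →
                     rank x < rank y → rank y < rank z → rank z < rank w → ⊥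
  rank-noncrossing {x} {y} {z} {w} xz yw
    with rank x | shift-view (P x) | rank y | shift-view (P y)
       | rank z | shift-view (P z) | rank w | shift-view (P w)
  ... | _ | kept _  | _ | kept _  | _ | kept _  | _ | kept _ = λ x<y y<z z<w →
    noncrossing E x z y w xz yw (x<y , y<z , z<w)
  ... | _ | kept hx | _ | kept _  | _ | kept _  | _ | moved hw = λ x<y y<z _ →
    noncrossing E w y x z (Graph.sym G yw) xz (<-≤-trans hw hx , x<y , y<z)
  ... | _ | kept hx | _ | kept _  | _ | moved _ | _ | moved hw = λ x<y _ z<w →
    noncrossing E z x w y (Graph.sym G xz) (Graph.sym G yw)
      (+-cancelʳ-< n (P z) (P w) z<w , <-≤-trans hw hx , x<y)
  ... | _ | kept hx | _ | moved _ | _ | moved _ | _ | moved hw = λ _ y<z z<w →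
    noncrossing E y w z x yw (Graph.sym G xz)
      (+-cancelʳ-< n (P y) (P z) y<z , +-cancelʳ-< n (P z) (P w) z<w , <-≤-trans hw hx)
  ... | _ | moved _ | _ | moved _ | _ | moved _ | _ | moved _ = λ x<y y<z z<w →
    noncrossing E x z y w xz yw
      (+-cancelʳ-< n (P x) (P y) x<y , +-cancelʳ-< n (P y) (P z) y<z , +-cancelʳ-< n (P z) (P w) z<w)
  ... | _ | moved _ | _ | kept _ | _ | _ | _ | _ = λ x<y _ _ → moved≮kept y x<y
  ... | _ | _ | _ | moved _ | _ | kept _ | _ | _ = λ _ y<z _ → moved≮kept z y<z
  ... | _ | _ | _ | _ | _ | moved _ | _ | kept _ = λ _ _ z<w → moved≮kept w z<w

  jumps-over : ∀ {S s t h} → S h → Walk G S s t → rank s < rank h → rank h < rank t →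
               ∃₂ λ x y → ¬ S x × Adj G x y × rank x < rank h × rank h < rank y
  jumps-over Sh (here _) s<h h<t = ⊥-elim (<-asym s<h h<t)
  jumps-over {S} {s} {h = h} Sh (step s∉S sw W) s<h h<t with <-cmp (rank _) (rank h)
  ... | tri< w<h _ _ = jumps-over Sh W w<h h<t
  ... | tri≈ _ w≡h _ = ⊥-elim (source∉ W (subst S (≡-sym (rank-injective w≡h)) Sh))
  ... | tri> _ _ h<w = s , _ , s∉S , sw , s<h , h<w

-- For an exterior edge ab the circle runs from a to b, so every other edge
-- lies between them in rank order.
module ExteriorEdge {n : ℕ} {G : Graph n} (bic : Biconnected G) (E : OuterplanarEmbedding G)
                    {a b : Fin n} (b↝a : CyclicSucc (pos E b) (pos E a)) where
  open Rotation E a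

  Ends : VSet n
  Ends w = w ≡ a ⊎ w ≡ b

  rank-maximal : ∀ v → rank v ≤ rank b
  rank-maximal v = from-cyclic b↝a
    where
    from-cyclic : CyclicSucc (pos E b) (pos E a) → rank v ≤ rank b
    from-cyclic cyc with rank v | shift-view (P v) | rank b | shift-view (P b) | cyc
    ... | _ | _ | _ | kept A≤b | inj₁ b+1≡A = ⊥-elim (<⇒≱ (subst (P b <_) b+1≡A ≤-refl) A≤b)
    ... | _ | kept _ | _ | moved _ | inj₁ _ = ≤-trans (<⇒≤ (P<n v)) (m≤n+m n (P b))
    ... | _ | moved v<A | _ | moved _ | inj₁ b+1≡A =
      +-monoˡ-≤ n (s≤s⁻¹ (subst (P v <_) (≡-sym b+1≡A) v<A))
    ... | _ | kept _ | _ | kept _ | inj₂ (b+1≡n , _) = s≤s⁻¹ (subst (P v <_) (≡-sym b+1≡n) (P<n v))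
    ... | _ | moved v<A | _ | _ | inj₂ (_ , A≡0) = ⊥-elim (n≮0 (subst (P v <_) A≡0 v<A))
    ... | _ | _ | _ | moved b<A | inj₂ (_ , A≡0) = ⊥-elim (n≮0 (subst (P b <_) A≡0 b<A))

  a<rank : ∀ {v} → ¬ v ≡ a → rank a < rank v
  a<rank v≢a = ≤∧≢⇒< (rank-minimal _) (λ eq → v≢a (≡-sym (rank-injective eq)))

  rank<b : ∀ {v} → ¬ v ≡ b → rank v < rank b
  rank<b v≢b = ≤∧≢⇒< (rank-maximal _) (λ eq → v≢b (rank-injective eq))

  -- A detour from q to p avoiding a either reaches p before b, or it reaches b
  -- and so jumps over p by an edge that crosses ap.
  linked-ordered : ∀ {p q} → ¬ Ends p → ¬ Ends q → Adj G a p → Adj G a q →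
                   rank q < rank p → Walk G Ends q p
  linked-ordered {p} {q} p∉ q∉ ap _ q<p
    with first-entry ((_≟ p) ∪? (_≟ b)) (proj₂ bic a q p (q∉ ∘ inj₁) (p∉ ∘ inj₁)) (inj₁ refl)
  ... | inj₁ (inj₁ q≡p) = ⊥-elim (<-irrefl (cong rank q≡p) q<p)
  ... | inj₁ (inj₂ q≡b) = ⊥-elim (q∉ (inj₂ q≡b))
  ... | inj₂ (_ , _ , W , wp , inj₁ refl) =
    extend (walk-antimono [ inj₁ , inj₂ ∘ inj₂ ] W) wp p∉
  ... | inj₂ (_ , _ , W , wb , inj₂ refl)
    with jumps-over (inj₂ refl) (extend (walk-antimono [ inj₁ , inj₂ ∘ inj₁ ] W) wb b∉)
                    q<p (rank<b (p∉ ∘ inj₂))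
    where
    b∉ : ¬ (b ≡ a ⊎ b ≡ p)
    b∉ = [ (λ b≡a → <⇒≱ (a<rank (q∉ ∘ inj₁)) (subst (λ c → rank q ≤ rank c) b≡a (rank-maximal q)))
         , p∉ ∘ inj₂ ∘ ≡-sym ]
  ...   | x , y , x∉ , xy , x<p , p<y = ⊥-elim (rank-noncrossing ap xy (a<rank (x∉ ∘ inj₁)) x<p p<y)

  neighbours-linked : ∀ {p q} → ¬ Ends p → ¬ Ends q → Adj G a p → Adj G a q → Walk G Ends p q
  neighbours-linked {p} {q} p∉ q∉ ap aq with <-cmp (rank p) (rank q)
  ... | tri< p<q _ _ = linked-ordered q∉ p∉ aq ap p<q
  ... | tri≈ _ p≡q _ = subst (Walk G Ends p) (rank-injective p≡q) (here p∉)
  ... | tri> _ _ q<p = reverse (linked-ordered p∉ q∉ ap aq q<p)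

  bypass : ∀ {u v} → Walk G ｛ b ｝ u v → ¬ Ends u → ¬ Ends v → Walk G Ends u v
  bypass (here _) u∉ _ = here u∉
  bypass (step {w = w} _ uw W) u∉ v∉ with w ≟ a
  ... | no w≢a = step u∉ uw (bypass W [ w≢a , source∉ W ] v∉)
  bypass (step _ _ (here _)) _ v∉ | yes refl = ⊥-elim (v∉ (inj₁ refl))
  bypass (step _ ua (step _ aw′ W′)) u∉ v∉ | yes refl =
    neighbours-linked u∉ w′∉ (Graph.sym G ua) aw′ ++ʷ bypass W′ w′∉ v∉
    where
    w′∉ : ¬ Ends _
    w′∉ = [ (λ w′≡a → irrefl G (subst (Adj G a) w′≡a aw′)) , source∉ W′ ]

  allReachable : AllReachable G Ends
  allReachable u v u∉ v∉ = bypass (proj₂ bic b u v (u∉ ∘ inj₂) (v∉ ∘ inj₂)) u∉ v∉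

allReachable-exterior : ∀ {n} {G : Graph n} → Biconnected G → (e : Edge G) → Exterior e →
                        AllReachable G (V e)
allReachable-exterior bic e (E , inj₂ b↝a) = ExteriorEdge.allReachable bic E b↝a
allReachable-exterior bic e (E , inj₁ a↝b) u v u∉ v∉ =
  walk-antimono swap (ExteriorEdge.allReachable bic E a↝b u v (u∉ ∘ swap) (v∉ ∘ swap))

adj⇒≢ : ∀ {n} (G : Graph n) {u v} → Adj G u v → ¬ u ≡ v
adj⇒≢ G uv refl = irrefl G uv

neighbour-avoiding : ∀ {n} {G : Graph n} → Biconnected G → ∀ {s t x} →
                     ¬ s ≡ t → ¬ x ≡ s → ¬ x ≡ t → ∃ λ z → Adj G s z × ¬ z ≡ t
neighbour-avoiding bic {s} {t} {x} s≢t x≢s x≢t with proj₂ bic t s x s≢t x≢t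
... | here _ = ⊥-elim (x≢s refl)
... | step _ sz W = _ , sz , source∉ W

neighbour-off-edge : ∀ {n} {G : Graph n} → Biconnected G → (e : Edge G) → ∀ {x w} →
                     ¬ V e x → V e w → ∃ λ z → ¬ V e z × Adj G w z
neighbour-off-edge {G = G} bic e x∉ (inj₁ refl)
  with neighbour-avoiding bic (adj⇒≢ G (adj e)) (x∉ ∘ inj₁) (x∉ ∘ inj₂)
... | z , wz , z≢t = z , [ adj⇒≢ G wz ∘ ≡-sym , z≢t ] , wz
neighbour-off-edge {G = G} bic e x∉ (inj₂ refl)
  with neighbour-avoiding bic (adj⇒≢ G (adj e) ∘ ≡-sym) (x∉ ∘ inj₂) (x∉ ∘ inj₁)
... | z , wz , z≢t = z , [ z≢t , adj⇒≢ G wz ∘ ≡-sym ] , wz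

module Separation {n : ℕ} {G : Graph n} (e₁ e₂ e₃ : Edge G)
                  (e₁#e₂ : V e₁ ⊆ ∁ (V e₂)) (e₃#e₂ : V e₃ ⊆ ∁ (V e₂))
                  (separated : ¬ Walk G (V e₂) (ends₁ e₁) (ends₁ e₃)) where

  X : VSet n
  X = V e₁ ∪ V e₃

  x : Fin n
  x = ends₁ e₂

  e₂∉X : V e₂ ⊆ ∁ X
  e₂∉X v₂ = [ (λ v₁ → e₁#e₂ v₁ v₂) , (λ v₃ → e₃#e₂ v₃ v₂) ]

  x∉X : ¬ X x
  x∉X = e₂∉X (inj₁ refl)

  no-walk-between : ∀ {z z′} → V e₁ z → V e₃ z′ → ¬ Walk G (V e₂) z z′
  no-walk-between v₁ v₃ W =
    separated (from-ends₁ e₁ e₁#e₂ v₁ (reverse (from-ends₁ e₃ e₃#e₂ v₃ (reverse W))))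
    where
    from-ends₁ : ∀ (e : Edge G) {z t} → V e ⊆ ∁ (V e₂) → V e z → Walk G (V e₂) z t →
                 Walk G (V e₂) (ends₁ e) t
    from-ends₁ e _ (inj₁ refl) W = W
    from-ends₁ e e#e₂ (inj₂ refl) W = step (e#e₂ (inj₁ refl)) (adj e) W

  no-edge-between : ∀ {z z′} → V e₁ z → V e₃ z′ → ¬ Adj G z z′
  no-edge-between v₁ v₃ zz′ = no-walk-between v₁ v₃ (step (e₁#e₂ v₁) zz′ (here (e₃#e₂ v₃)))

  to-x : ∀ {m} → V e₂ m → Walk G X m x
  to-x (inj₁ refl) = here x∉X
  to-x (inj₂ refl) = step (e₂∉X (inj₂ refl)) (Graph.sym G (adj e₂)) (to-x (inj₁ refl))

  reach-e₂-or-other : ∀ {S H : VSet n} {u} → Decidable H → V e₂ ⊆ ∁ S → H ⊆ ∁ (V e₂) →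
                      Walk G S u x → ¬ H u →
                      (∃ λ m → V e₂ m × Walk G (S ∪ H) u m) ⊎ (∃ λ h → H h × Walk G (V e₂) u h)
  reach-e₂-or-other {S} {H} {u} H? e₂∉S H#e₂ W u∉H
    with first-entry (V? e₂ ∪? H?) W (inj₁ (inj₁ refl))
  ... | inj₁ (inj₁ v₂) = inj₁ (u , v₂ , here [ source∉ W , u∉H ])
  ... | inj₁ (inj₂ h) = ⊥-elim (u∉H h)
  ... | inj₂ (_ , m , W′ , wm , inj₁ v₂) =
    inj₁ (m , v₂ , extend (walk-antimono [ inj₁ , inj₂ ∘ inj₂ ] W′) wm
                          [ e₂∉S v₂ , (λ h → H#e₂ h v₂) ])
  ... | inj₂ (_ , h , W′ , wh , inj₂ Hh) =
    inj₂ (h , Hh , extend (walk-antimono (inj₂ ∘ inj₁) W′) wh (H#e₂ Hh))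

  reach-x : AllReachable G (V e₁) → AllReachable G (V e₃) → ∀ {u} → ¬ X u → Walk G X u x
  reach-x ext₁ ext₃ {u} u∉X
    with reach-e₂-or-other (V? e₃) (λ v₂ v₁ → e₁#e₂ v₁ v₂) e₃#e₂
           (ext₁ u x (u∉X ∘ inj₁) (x∉X ∘ inj₁)) (u∉X ∘ inj₂)
  ... | inj₁ (_ , v₂ , W) = W ++ʷ to-x v₂
  ... | inj₂ (_ , v₃ , W₃)
    with reach-e₂-or-other (V? e₁) (λ v₂ v₃ → e₃#e₂ v₃ v₂) e₁#e₂
           (ext₃ u x (u∉X ∘ inj₂) (x∉X ∘ inj₂)) (u∉X ∘ inj₁)
  ...   | inj₁ (_ , v₂ , W) = walk-antimono swap W ++ʷ to-x v₂
  ...   | inj₂ (_ , v₁ , W₁) = ⊥-elim (no-walk-between v₁ v₃ (reverse W₁ ++ʷ W₃))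

  connected : AllReachable G (V e₁) → AllReachable G (V e₃) → ConnectedMinus G X
  connected ext₁ ext₃ =
    (x , x∉X) , λ u v u∉X v∉X → reach-x ext₁ ext₃ u∉X ++ʷ reverse (reach-x ext₁ ext₃ v∉X)

  outside-neighbour : Biconnected G → ∀ {w} → X w → ∃ λ z → ¬ X z × Adj G w z
  outside-neighbour bic (inj₁ v₁) with neighbour-off-edge bic e₁ (x∉X ∘ inj₁) v₁
  ... | z , z∉e₁ , wz = z , [ z∉e₁ , (λ v₃ → no-edge-between v₁ v₃ wz) ] , wz
  outside-neighbour bic (inj₂ v₃) with neighbour-off-edge bic e₃ (x∉X ∘ inj₂) v₃
  ... | z , z∉e₃ , wz = z , [ (λ v₁ → no-edge-between v₁ v₃ (Graph.sym G wz)) , z∉e₃ ] , wz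

  neighbourhood : Biconnected G → ∀ w → N G (∁ X) w ⇔ X w
  neighbourhood bic w =
    mk⇔ (λ (¬¬Xw , _) → decidable-stable ((V? e₁ ∪? V? e₃) w) ¬¬Xw)
        (λ Xw → (λ w∉X → w∉X Xw) , outside-neighbour bic Xw)

lemma46 : ∀ {n} (G : Graph n) → Biconnected G → Outerplanar G →
          (e₁ e₂ e₃ : Edge G) → OrderRespecting 3 (seq3 e₁ e₂ e₃) →
          Exterior e₁ → Interior e₂ → Exterior e₃ →
          ConnectedMinus G (V e₁ ∪ V e₃) ×
          (∀ w → N G (Complement (V e₁ ∪ V e₃)) w ⇔ (V e₁ ∪ V e₃) w)
lemma46 G bic _ e₁ e₂ e₃ (disjoint , separated) ext₁ _ ext₃ =
  connected (allReachable-exterior bic e₁ ext₁) (allReachable-exterior bic e₃ ext₃) ,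
  neighbourhood bic
  where
  open Separation e₁ e₂ e₃
    (λ {w} → disjoint (# 0) (# 1) (λ ()) w)
    (λ {w} → disjoint (# 2) (# 1) (λ ()) w)
    (separated (# 0) (# 1) (# 2) (s≤s z≤n) (s≤s (s≤s z≤n)))
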